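{- Let $a,b$ be positive integers, let $w_1$ be a positive integer and $w_0$ a nonnegative integer, and let $(w_n)_{n\ge 0}$ be defined by $w_n=a^{\zeta(n+1)}b^{\zeta(n)}w_{n-1}+w_{n-2}$ for $n\geq 2$, where $\zeta(n)=\frac{1-(-1)^n}{2}$. Then for every integer $n>0$, $$\sum_{k=0}^{n-1}\left(\frac{a}{b}\right)^{\zeta(k)}w_k^2=\frac{1}{b}\left(w_nw_{n-1}-w_0w_1+bw_0^2\right).$$
   Context: $\zeta(n)=\frac{1-(-1)^n}{2}$ equals $0$ for even $n$ and $1$ for odd $n$. The sequence $(w_n)$ is called the generalized bi-periodic Fibonacci sequence. -}

module Defs where

open import Data.Nat using (ℕ; zero; suc; _+_; _*_; _^_)
open import Data.Integer using (+_)
open import Data.Rational using (ℚ; 0ℚ; 1ℚ; _/_) renaming (_+_ to _+ℚ_; _*_ to _*ℚ_)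

ζ : ℕ → ℕ
ζ zero = 0
ζ (suc zero) = 1
ζ (suc (suc n)) = ζ n

_^ℚ_ : ℚ → ℕ → ℚ
q ^ℚ zero = 1ℚ
q ^ℚ suc n = q *ℚ (q ^ℚ n)

ℕ→ℚ : ℕ → ℚ
ℕ→ℚ k = (+ k) / 1

w : (a b w₀ w₁ : ℕ) → ℕ → ℕ
w a b w₀ w₁ zero = w₀
w a b w₀ w₁ (suc zero) = w₁
w a b w₀ w₁ (suc (suc n)) =
  a ^ ζ (suc (suc (suc n))) * b ^ ζ (suc (suc n)) * w a b w₀ w₁ (suc n) + w a b w₀ w₁ n

Σ< : ℕ → (ℕ → ℚ) → ℚ
Σ< zero f = 0ℚ
Σ< (suc n) f = Σ< n f +ℚ f n

-- By the recurrence, w(k+1) w(k) - w(k) w(k-1) = a^ζ(k) b^ζ(k+1) w(k)², and since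
-- ζ(k) + ζ(k+1) = 1 this is b (a/b)^ζ(k) w(k)².  So b times the weighted sum of squares
-- telescopes to w(n) w(n-1) - w(1) w(0), plus the k = 0 term b w(0)².
module Submission where

open import Defs
open import Data.Nat using (ℕ; zero; suc; NonZero; _<_; _∸_; _^_)
  renaming (_+_ to _+ℕ_; _*_ to _*ℕ_)
import Data.Nat.Properties as ℕ
import Data.Nat.Solver as ℕ-Solver
open import Data.Integer using (ℤ; +_)
import Data.Integer as ℤ
open import Data.Integer.Properties using (pos-+; pos-*)
import Data.Integer.Solver as ℤ-Solver
open import Data.Rational using (ℚ; 0ℚ; 1ℚ; _/_; _+_; _-_; _*_; toℚᵘ; fromℚᵘ)
open import Data.Rational.Properties
  using (toℚᵘ-injective; toℚᵘ-fromℚᵘ; fromℚᵘ-cong; toℚᵘ-homo-+; toℚᵘ-homo-*)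
import Data.Rational.Properties as ℚ
import Data.Rational.Solver as ℚ-Solver
open import Data.Rational.Unnormalised as ℚᵘ using (mkℚᵘ; *≡*)
import Data.Rational.Unnormalised.Properties as ℚᵘ
open import Relation.Binary.PropositionalEquality

fromℚᵘ-homo-+ : ∀ p q → fromℚᵘ (p ℚᵘ.+ q) ≡ fromℚᵘ p + fromℚᵘ q
fromℚᵘ-homo-+ p q = toℚᵘ-injective (begin-equality
  toℚᵘ (fromℚᵘ (p ℚᵘ.+ q))              ≃⟨ toℚᵘ-fromℚᵘ (p ℚᵘ.+ q) ⟩
  p ℚᵘ.+ q                               ≃⟨ ℚᵘ.+-cong (toℚᵘ-fromℚᵘ p) (toℚᵘ-fromℚᵘ q) ⟨
  toℚᵘ (fromℚᵘ p) ℚᵘ.+ toℚᵘ (fromℚᵘ q)  ≃⟨ toℚᵘ-homo-+ (fromℚᵘ p) (fromℚᵘ q) ⟨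
  toℚᵘ (fromℚᵘ p + fromℚᵘ q)            ∎)
  where open ℚᵘ.≤-Reasoning

fromℚᵘ-homo-* : ∀ p q → fromℚᵘ (p ℚᵘ.* q) ≡ fromℚᵘ p * fromℚᵘ q
fromℚᵘ-homo-* p q = toℚᵘ-injective (begin-equality
  toℚᵘ (fromℚᵘ (p ℚᵘ.* q))              ≃⟨ toℚᵘ-fromℚᵘ (p ℚᵘ.* q) ⟩
  p ℚᵘ.* q                               ≃⟨ ℚᵘ.*-cong (toℚᵘ-fromℚᵘ p) (toℚᵘ-fromℚᵘ q) ⟨
  toℚᵘ (fromℚᵘ p) ℚᵘ.* toℚᵘ (fromℚᵘ q)  ≃⟨ toℚᵘ-homo-* (fromℚᵘ p) (fromℚᵘ q) ⟨
  toℚᵘ (fromℚᵘ p * fromℚᵘ q)            ∎)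
  where open ℚᵘ.≤-Reasoning

-- ℕ→ℚ k and i / suc d are definitionally fromℚᵘ (mkℚᵘ (+ k) 0) and fromℚᵘ (mkℚᵘ i d),
-- so the arithmetic below reduces to cross-multiplied identities in ℤ.
ℕ→ℚ-homo-+ : ∀ x y → ℕ→ℚ (x +ℕ y) ≡ ℕ→ℚ x + ℕ→ℚ y
ℕ→ℚ-homo-+ x y =
  trans (fromℚᵘ-cong {mkℚᵘ (+ (x +ℕ y)) 0} {mkℚᵘ (+ x) 0 ℚᵘ.+ mkℚᵘ (+ y) 0} (*≡* cross))
        (fromℚᵘ-homo-+ (mkℚᵘ (+ x) 0) (mkℚᵘ (+ y) 0))
  where
  open ℤ-Solver.+-*-Solver
  cross : + (x +ℕ y) ℤ.* + 1 ≡ (+ x ℤ.* + 1 ℤ.+ + y ℤ.* + 1) ℤ.* + 1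
  cross rewrite pos-+ x y =
    solve 2 (λ p q → (p :+ q) :* con (+ 1) := (p :* con (+ 1) :+ q :* con (+ 1)) :* con (+ 1))
      refl (+ x) (+ y)

ℕ→ℚ-homo-* : ∀ x y → ℕ→ℚ (x *ℕ y) ≡ ℕ→ℚ x * ℕ→ℚ y
ℕ→ℚ-homo-* x y =
  trans (fromℚᵘ-cong {mkℚᵘ (+ (x *ℕ y)) 0} {mkℚᵘ (+ x) 0 ℚᵘ.* mkℚᵘ (+ y) 0}
                     (*≡* (cong (ℤ._* + 1) (pos-* x y))))
        (fromℚᵘ-homo-* (mkℚᵘ (+ x) 0) (mkℚᵘ (+ y) 0))

i/n≡i*1/n : ∀ (i : ℤ) n .{{_ : NonZero n}} → i / n ≡ (i / 1) * ((+ 1) / n)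
i/n≡i*1/n i (suc d) =
  trans (fromℚᵘ-cong {mkℚᵘ i d} {mkℚᵘ i 0 ℚᵘ.* mkℚᵘ (+ 1) d} (*≡* cross))
        (fromℚᵘ-homo-* (mkℚᵘ i 0) (mkℚᵘ (+ 1) d))
  where
  open ℤ-Solver.+-*-Solver
  cross : i ℤ.* + (1 *ℕ suc d) ≡ (i ℤ.* + 1) ℤ.* + suc d
  cross rewrite ℕ.*-identityˡ (suc d) =
    solve 2 (λ p q → p :* q := (p :* con (+ 1)) :* q) refl i (+ suc d)

1/n*n≡1 : ∀ n .{{_ : NonZero n}} → ((+ 1) / n) * ℕ→ℚ n ≡ 1ℚ
1/n*n≡1 (suc d) =
  trans (sym (fromℚᵘ-homo-* (mkℚᵘ (+ 1) d) (mkℚᵘ (+ suc d) 0)))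
        (fromℚᵘ-cong {mkℚᵘ (+ 1) d ℚᵘ.* mkℚᵘ (+ suc d) 0} {mkℚᵘ (+ 1) 0} (*≡* cross))
  where
  open ℤ-Solver.+-*-Solver
  cross : (+ 1 ℤ.* + suc d) ℤ.* + 1 ≡ + 1 ℤ.* + (suc d *ℕ 1)
  cross = trans (solve 1 (λ q → (con (+ 1) :* q) :* con (+ 1) := con (+ 1) :* (q :* con (+ 1)))
                  refl (+ suc d))
                (cong (+ 1 ℤ.*_) (sym (pos-* (suc d) 1)))

module _ (a b w₀ w₁ : ℕ) .{{_ : NonZero b}} where

  W : ℕ → ℕ
  W = w a b w₀ w₁

  r : ℚ
  r = (+ 1) / b

  1*b*1≡b : 1 *ℕ (b *ℕ 1) ≡ b
  1*b*1≡b = trans (ℕ.*-identityˡ (b *ℕ 1)) (ℕ.*-identityʳ b)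

  w-product-step : ∀ k →
    W (suc (suc k)) *ℕ W (suc k)
      ≡ a ^ ζ (suc k) *ℕ b ^ ζ k *ℕ (W (suc k) *ℕ W (suc k)) +ℕ W (suc k) *ℕ W k
  w-product-step k = solve 3 (λ c x v → (c :* x :+ v) :* x := c :* (x :* x) :+ x :* v)
                       refl (a ^ ζ (suc k) *ℕ b ^ ζ k) (W (suc k)) (W k)
    where open ℕ-Solver.+-*-Solver

  weight-over-b : ∀ k Q →
    (((+ a) / b) ^ℚ ζ k) * ℕ→ℚ Q ≡ r * ℕ→ℚ (a ^ ζ k *ℕ b ^ ζ (suc k) *ℕ Q)
  weight-over-b zero Q = begin
    1ℚ * ℕ→ℚ Q                    ≡⟨ cong (_* ℕ→ℚ Q) (1/n*n≡1 b) ⟨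
    (r * ℕ→ℚ b) * ℕ→ℚ Q           ≡⟨ ℚ.*-assoc r (ℕ→ℚ b) (ℕ→ℚ Q) ⟩
    r * (ℕ→ℚ b * ℕ→ℚ Q)           ≡⟨ cong (r *_) (ℕ→ℚ-homo-* b Q) ⟨
    r * ℕ→ℚ (b *ℕ Q)              ≡⟨ cong (λ c → r * ℕ→ℚ (c *ℕ Q)) 1*b*1≡b ⟨
    r * ℕ→ℚ (1 *ℕ (b *ℕ 1) *ℕ Q)  ∎
    where open ≡-Reasoning
  weight-over-b (suc zero) Q = begin
    ((+ a) / b * 1ℚ) * ℕ→ℚ Q      ≡⟨ cong (_* ℕ→ℚ Q) (ℚ.*-identityʳ ((+ a) / b)) ⟩
    ((+ a) / b) * ℕ→ℚ Q           ≡⟨ cong (_* ℕ→ℚ Q) (i/n≡i*1/n (+ a) b) ⟩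
    (ℕ→ℚ a * r) * ℕ→ℚ Q           ≡⟨ cong (_* ℕ→ℚ Q) (ℚ.*-comm (ℕ→ℚ a) r) ⟩
    (r * ℕ→ℚ a) * ℕ→ℚ Q           ≡⟨ ℚ.*-assoc r (ℕ→ℚ a) (ℕ→ℚ Q) ⟩
    r * (ℕ→ℚ a * ℕ→ℚ Q)           ≡⟨ cong (r *_) (ℕ→ℚ-homo-* a Q) ⟨
    r * ℕ→ℚ (a *ℕ Q)              ≡⟨ cong (λ c → r * ℕ→ℚ (c *ℕ Q)) a*1*1≡a ⟨
    r * ℕ→ℚ (a *ℕ 1 *ℕ 1 *ℕ Q)    ∎
    where
    open ≡-Reasoning
    a*1*1≡a : a *ℕ 1 *ℕ 1 ≡ a
    a*1*1≡a = trans (ℕ.*-identityʳ (a *ℕ 1)) (ℕ.*-identityʳ a)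
  weight-over-b (suc (suc k)) Q = weight-over-b k Q

  sum-weighted-squares : ∀ m →
    Σ< (suc m) (λ k → (((+ a) / b) ^ℚ ζ k) * ℕ→ℚ (W k *ℕ W k))
      ≡ r * (ℕ→ℚ (W (suc m) *ℕ W m) - ℕ→ℚ (w₀ *ℕ w₁) + ℕ→ℚ (b *ℕ w₀ *ℕ w₀))
  sum-weighted-squares zero = begin
    0ℚ + 1ℚ * ℕ→ℚ (w₀ *ℕ w₀)                 ≡⟨ cong (_+_ 0ℚ) (weight-over-b 0 (w₀ *ℕ w₀)) ⟩
    0ℚ + r * ℕ→ℚ (1 *ℕ (b *ℕ 1) *ℕ (w₀ *ℕ w₀)) ≡⟨ cong (λ n → 0ℚ + r * ℕ→ℚ n) b*w₀² ⟩
    0ℚ + r * D                                ≡⟨ add-C-minus-C ⟩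
    r * (C - C + D)                           ≡⟨ cong (λ n → r * (ℕ→ℚ n - C + D)) (ℕ.*-comm w₀ w₁) ⟩
    r * (ℕ→ℚ (w₁ *ℕ w₀) - C + D)              ∎
    where
    open ≡-Reasoning
    C D : ℚ
    C = ℕ→ℚ (w₀ *ℕ w₁)
    D = ℕ→ℚ (b *ℕ w₀ *ℕ w₀)
    add-C-minus-C : 0ℚ + r * D ≡ r * (C - C + D)
    add-C-minus-C = solve 3 (λ r c d → con 0ℚ :+ r :* d := r :* (c :- c :+ d)) refl r C D
      where
      open ℚ-Solver.+-*-Solver using (solve; con; _:+_; _:-_; _:*_; _:=_)
    b*w₀² : 1 *ℕ (b *ℕ 1) *ℕ (w₀ *ℕ w₀) ≡ b *ℕ w₀ *ℕ w₀
    b*w₀² = trans (cong (_*ℕ (w₀ *ℕ w₀)) 1*b*1≡b) (sym (ℕ.*-assoc b w₀ w₀))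
  sum-weighted-squares (suc m) = begin
    Σ< (suc m) f + f (suc m)                    ≡⟨ cong₂ _+_ (sum-weighted-squares m)
                                                             (weight-over-b (suc m) (W (suc m) *ℕ W (suc m))) ⟩
    r * (P - C + D) + r * ℕ→ℚ Y                 ≡⟨ solve 5 (λ r p c d y → r :* (p :- c :+ d) :+ r :* y := r :* ((y :+ p) :- c :+ d))
                                                     refl r P C D (ℕ→ℚ Y) ⟩
    r * ((ℕ→ℚ Y + P) - C + D)                   ≡⟨ cong (λ t → r * (t - C + D)) (ℕ→ℚ-homo-+ Y (W (suc m) *ℕ W m)) ⟨
    r * (ℕ→ℚ (Y +ℕ W (suc m) *ℕ W m) - C + D)   ≡⟨ cong (λ n → r * (ℕ→ℚ n - C + D)) (w-product-step m) ⟨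
    r * (ℕ→ℚ (W (suc (suc m)) *ℕ W (suc m)) - C + D) ∎
    where
    open ≡-Reasoning
    open ℚ-Solver.+-*-Solver using (solve; con; _:+_; _:-_; _:*_; _:=_)
    f : ℕ → ℚ
    f k = (((+ a) / b) ^ℚ ζ k) * ℕ→ℚ (W k *ℕ W k)
    C D P : ℚ
    C = ℕ→ℚ (w₀ *ℕ w₁)
    D = ℕ→ℚ (b *ℕ w₀ *ℕ w₀)
    P = ℕ→ℚ (W (suc m) *ℕ W m)
    Y : ℕ
    Y = a ^ ζ (suc m) *ℕ b ^ ζ m *ℕ (W (suc m) *ℕ W (suc m))

mainTheorem2 : (a b w₀ w₁ : ℕ) → 0 < a → {{_ : NonZero b}} → 0 < w₁ →
    (n : ℕ) → 0 < n →
    Σ< n (λ k → (((+ a) / b) ^ℚ ζ k) * ℕ→ℚ (w a b w₀ w₁ k *ℕ w a b w₀ w₁ k))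
      ≡ ((+ 1) / b) * (ℕ→ℚ (w a b w₀ w₁ n *ℕ w a b w₀ w₁ (n ∸ 1))
                        - ℕ→ℚ (w₀ *ℕ w₁) + ℕ→ℚ (b *ℕ w₀ *ℕ w₀))
mainTheorem2 a b w₀ w₁ _ _ (suc m) _ = sum-weighted-squares a b w₀ w₁ m
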